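{- Let $k$ be a positive integer and let $G$ be a $k$-tree. If $G$ has a perfect $(k+1)$-cover, then $G$ is $\alpha$-excellent.
   Context: All graphs are finite and simple. For a positive integer $k$, a $k$-tree is a graph obtainable from the complete graph $K_k$ by finitely many applications of the operation: add a new vertex and join it to $k$ mutually adjacent vertices of the existing graph. A perfect $(k+1)$-cover of a graph $G$ is a set $\mathcal P$ of complete subgraphs of $G$, each of order $k+1$, such that every vertex of $G$ belongs to exactly one subgraph in $\mathcal P$. $\alpha(G)$ is the independence number; an $\alpha$-set is an independent set of size $\alpha(G)$; $G$ is $\alpha$-excellent if every vertex of $G$ lies in some $\alpha$-set of $G$. -}

module Defs where

open import Data.Nat using (ℕ; suc; _≤_)
open import Data.Bool using (Bool; true; false)
open import Data.Fin using (Fin; punchIn)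
open import Data.Fin.Subset using (Subset; _∈_; ∣_∣)
open import Data.Vec using (lookup)
open import Data.List using (List; length)
import Data.List as L
open import Data.Product using (Σ; ∃; _×_)
open import Relation.Binary.PropositionalEquality using (_≡_; _≢_)
open import Relation.Nullary using (¬_)

record Graph (n : ℕ) : Set where
  field
    adj   : Fin n → Fin n → Bool
    sym   : ∀ x y → adj x y ≡ adj y x
    irrefl : ∀ x → adj x x ≡ false
open Graph public

IsClique : ∀ {n} → Graph n → Subset n → Set
IsClique G S = ∀ x y → x ∈ S → y ∈ S → x ≢ y → adj G x y ≡ true

IsIndependent : ∀ {n} → Graph n → Subset n → Set
IsIndependent G S = ∀ x y → x ∈ S → y ∈ S → adj G x y ≡ false

IsAlphaSet : ∀ {n} → Graph n → Subset n → Set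
IsAlphaSet G S = IsIndependent G S × (∀ T → IsIndependent G T → ∣ T ∣ ≤ ∣ S ∣)

AlphaExcellent : ∀ {n} → Graph n → Set
AlphaExcellent {n} G = (v : Fin n) → ∃ λ S → IsAlphaSet G S × v ∈ S

IsComplete : ∀ {n} → Graph n → Set
IsComplete G = ∀ x y → x ≢ y → adj G x y ≡ true

-- Step: H on Fin (suc n) is obtained from G on Fin n by
-- adding a new vertex v (placed at any position; the old vertices are
-- relabelled by punchIn v) joined exactly to a k-clique S of G.
data KTree (k : ℕ) : (n : ℕ) → Graph n → Set where
  base : (G : Graph k) → IsComplete G → KTree k k G
  step : ∀ {n} (G : Graph n) → KTree k n G →
         (S : Subset n) → ∣ S ∣ ≡ k → IsClique G S →
         (H : Graph (suc n)) (v : Fin (suc n)) →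
         (∀ x y → adj H (punchIn v x) (punchIn v y) ≡ adj G x y) →
         (∀ x → adj H v (punchIn v x) ≡ lookup S x) →
         KTree k (suc n) H

IsPerfectCover : ∀ {n} → ℕ → Graph n → List (Subset n) → Set
IsPerfectCover {n} m G P =
  (∀ i → IsClique G (L.lookup P i) × ∣ L.lookup P i ∣ ≡ m) ×
  ((v : Fin n) → Σ (Fin (length P)) λ i →
     v ∈ L.lookup P i × (∀ j → v ∈ L.lookup P j → j ≡ i))

HasPerfectCover : ∀ {n} → ℕ → Graph n → Set
HasPerfectCover m G = ∃ λ P → IsPerfectCover m G P

{-# OPTIONS --safe #-}
module Submission where

-- A k-tree is properly (k+1)-colourable: each new vertex sees only a k-clique,
-- so some colour is free for it.  Every (k+1)-clique of the perfect cover then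
-- contains exactly one vertex of each colour, so every colour class has |P|
-- vertices, one in each clique of the cover P.  An independent set meets each
-- clique at most once, hence has at most |P| vertices.  So every colour class
-- is an α-set, and every vertex lies in its own colour class.

open import Defs hiding (sym)
open import Data.Nat using (ℕ; suc; _≤_; _<_)
open import Data.Nat.Properties using (≤-trans; ≤-reflexive; <-irrefl; 1+n≰n)
open import Data.Bool using (true; false)
open import Data.Fin using (Fin; zero; suc; punchIn; punchOut; inject₁; _≟_)
open import Data.Fin.Properties
  using (punchIn-punchOut; punchOut-injective;
         inject₁-injective; suc-injective; injective⇒≤; any?; ¬∀⟶∃¬)
open import Data.Fin.Subset using (Subset; _∈_; ∣_∣; inside; outside)
open import Data.Fin.Subset.Properties using (_∈?_)
open import Data.Vec using ([]; _∷_; lookup; tabulate; here; there)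
open import Data.Vec.Properties using ([]=⇒lookup; lookup⇒[]=; lookup∘tabulate)
open import Data.Vec.Functional using (insertAt)
open import Data.Vec.Functional.Properties using (insertAt-lookup; insertAt-punchIn)
open import Data.List using (List; length)
import Data.List as L
open import Data.Product using (Σ; ∃; _×_; _,_; proj₁; proj₂)
open import Function using (_∘_)
open import Function.Definitions using (Injective)
open import Relation.Binary.PropositionalEquality
  using (_≡_; _≢_; refl; sym; trans; cong; subst; module ≡-Reasoning)
open import Relation.Nullary using (¬_; yes; no; does)
open import Relation.Nullary.Decidable using (_×-dec_; dec-true)
open import Relation.Nullary.Negation using (contradiction)
open import Relation.Unary using (Pred; Decidable)

private
  variable
    n a b c : ℕ

record Enumeration (S : Subset n) : Set where
  field
    element           : Fin ∣ S ∣ → Fin n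
    element-injective : Injective _≡_ _≡_ element
    element-∈         : ∀ i → element i ∈ S
    index             : ∀ {x} → x ∈ S → Fin ∣ S ∣
    element-index     : ∀ {x} (x∈S : x ∈ S) → element (index x∈S) ≡ x

enumerate : (S : Subset n) → Enumeration S
enumerate [] = record
  { element = λ (); element-injective = λ {}; element-∈ = λ ()
  ; index = λ (); element-index = λ () }
enumerate (inside ∷ S) = record
  { element = element′; element-injective = injective; element-∈ = ∈S
  ; index = index′; element-index = element-index′ }
  where
  open Enumeration (enumerate S)
  element′ : Fin (suc ∣ S ∣) → Fin (suc _)
  element′ zero    = zero
  element′ (suc i) = suc (element i)
  injective : Injective _≡_ _≡_ element′
  injective {zero}  {zero}  _  = refl
  injective {suc i} {suc j} eq = cong suc (element-injective (suc-injective eq))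
  ∈S : ∀ i → element′ i ∈ inside ∷ S
  ∈S zero    = here
  ∈S (suc i) = there (element-∈ i)
  index′ : ∀ {x} → x ∈ inside ∷ S → Fin (suc ∣ S ∣)
  index′ here      = zero
  index′ (there m) = suc (index m)
  element-index′ : ∀ {x} (x∈S : x ∈ inside ∷ S) → element′ (index′ x∈S) ≡ x
  element-index′ here      = refl
  element-index′ (there m) = cong suc (element-index m)
enumerate (outside ∷ S) = record
  { element = suc ∘ element
  ; element-injective = element-injective ∘ suc-injective
  ; element-∈ = there ∘ element-∈
  ; index = λ { (there m) → index m }
  ; element-index = λ { (there m) → cong suc (element-index m) } }
  where open Enumeration (enumerate S)

InjectiveOn : Subset n → (Fin n → Fin b) → Set
InjectiveOn S f = ∀ {x y} → x ∈ S → y ∈ S → f x ≡ f y → x ≡ y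

∣S∣≤-injectiveOn : (S : Subset n) (f : ∀ x → x ∈ S → Fin b) →
  (∀ {x y} (x∈S : x ∈ S) (y∈S : y ∈ S) → f x x∈S ≡ f y y∈S → x ≡ y) → ∣ S ∣ ≤ b
∣S∣≤-injectiveOn S f f-inj =
  injective⇒≤ (element-injective ∘ f-inj (element-∈ _) (element-∈ _))
  where open Enumeration (enumerate S)

≤∣S∣-injectiveInto : (S : Subset n) (g : Fin a → Fin n) →
  Injective _≡_ _≡_ g → (∀ i → g i ∈ S) → a ≤ ∣ S ∣
≤∣S∣-injectiveInto S g g-inj g∈S = injective⇒≤ {f = index ∘ g∈S} index∘g-injective
  where
  open Enumeration (enumerate S)
  index∘g-injective : Injective _≡_ _≡_ (index ∘ g∈S)
  index∘g-injective {i} {j} eq = g-inj (begin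
    g i                      ≡⟨ sym (element-index (g∈S i)) ⟩
    element (index (g∈S i))  ≡⟨ cong element eq ⟩
    element (index (g∈S j))  ≡⟨ element-index (g∈S j) ⟩
    g j                      ∎)
    where open ≡-Reasoning

Hits : Subset n → (Fin n → Fin c) → Fin c → Set
Hits S col c₀ = ∃ λ x → x ∈ S × col x ≡ c₀

hits? : (S : Subset n) (col : Fin n → Fin c) → Decidable (Hits S col)
hits? S col c₀ = any? λ x → (x ∈? S) ×-dec (col x ≟ c₀)

missedColour : (S : Subset n) → ∣ S ∣ < c → (col : Fin n → Fin c) →
  ∃ λ c₀ → ¬ Hits S col c₀
missedColour {c = c} S ∣S∣<c col = ¬∀⟶∃¬ c _ (hits? S col) ¬allHit
  where
  ¬allHit : ¬ (∀ c₀ → Hits S col c₀)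
  ¬allHit hit = <-irrefl refl (≤-trans ∣S∣<c
    (≤∣S∣-injectiveInto S (proj₁ ∘ hit) witness-injective (proj₁ ∘ proj₂ ∘ hit)))
    where
    witness-injective : Injective _≡_ _≡_ (proj₁ ∘ hit)
    witness-injective {i} {j} eq =
      trans (sym (proj₂ (proj₂ (hit i)))) (trans (cong col eq) (proj₂ (proj₂ (hit j))))

everyColourHit : (S : Subset n) (col : Fin n → Fin c) → InjectiveOn S col →
  c ≤ ∣ S ∣ → ∀ c₀ → Hits S col c₀
everyColourHit {c = suc c} S col col-inj c<∣S∣ c₀ with hits? S col c₀
... | yes hit  = hit
... | no ¬hit = contradiction (≤-trans c<∣S∣ (∣S∣≤-injectiveOn S squeeze squeeze-injective)) 1+n≰n
  where
  avoids : ∀ {x} → x ∈ S → c₀ ≢ col x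
  avoids x∈S eq = ¬hit (_ , x∈S , sym eq)
  -- S misses colour c₀, so its colours fit into the remaining c colours
  squeeze : ∀ x → x ∈ S → Fin c
  squeeze x x∈S = punchOut (avoids x∈S)
  squeeze-injective : ∀ {x y} (x∈S : x ∈ S) (y∈S : y ∈ S) → squeeze x x∈S ≡ squeeze y y∈S → x ≡ y
  squeeze-injective x∈S y∈S = col-inj x∈S y∈S ∘ punchOut-injective (avoids x∈S) (avoids y∈S)

IsProperColouring : Graph n → (Fin n → Fin c) → Set
IsProperColouring G col = ∀ x y → adj G x y ≡ true → col x ≢ col y

proper⇒injectiveOn-clique : (G : Graph n) {col : Fin n → Fin c} → IsProperColouring G col →
  ∀ {C} → IsClique G C → InjectiveOn C col
proper⇒injectiveOn-clique G proper clique {x} {y} x∈C y∈C eq with x ≟ y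
... | yes x≡y = x≡y
... | no  x≢y = contradiction eq (proper x y (clique x y x∈C y∈C x≢y))

adj-irrefl : (G : Graph n) → ∀ {x y} → adj G x y ≡ true → x ≢ y
adj-irrefl G {x} adj≡true refl with trans (sym adj≡true) (irrefl G x)
... | ()

data PunchInView {n} (v : Fin (suc n)) : Fin (suc n) → Set where
  at-v    : PunchInView v v
  punched : ∀ y → PunchInView v (punchIn v y)

punchInView : (v y : Fin (suc n)) → PunchInView v y
punchInView v y with v ≟ y
... | yes refl = at-v
... | no  v≢y  = subst (PunchInView v) (punchIn-punchOut v≢y) (punched (punchOut v≢y))

insertAt-proper : (G : Graph n) (H : Graph (suc n)) (v : Fin (suc n)) (S : Subset n) →
  (∀ x y → adj H (punchIn v x) (punchIn v y) ≡ adj G x y) →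
  (∀ x → adj H v (punchIn v x) ≡ lookup S x) →
  {col : Fin n → Fin c} → IsProperColouring G col →
  {c₀ : Fin c} → ¬ Hits S col c₀ → IsProperColouring H (insertAt col v c₀)
insertAt-proper G H v S H≅G v~S {col} proper {c₀} c₀∉S = proper′
  where
  new-vs-old : ∀ y → adj H v (punchIn v y) ≡ true → insertAt col v c₀ v ≢ insertAt col v c₀ (punchIn v y)
  new-vs-old y adj≡true eq = c₀∉S (y , y∈S , sym (begin
    c₀                              ≡⟨ sym (insertAt-lookup col v c₀) ⟩
    insertAt col v c₀ v             ≡⟨ eq ⟩
    insertAt col v c₀ (punchIn v y) ≡⟨ insertAt-punchIn col v c₀ y ⟩
    col y                           ∎))
    where
    open ≡-Reasoning
    y∈S : y ∈ S
    y∈S = lookup⇒[]= y S (trans (sym (v~S y)) adj≡true)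
  proper′ : IsProperColouring H (insertAt col v c₀)
  proper′ x y adj≡true with punchInView v x | punchInView v y
  ... | at-v      | at-v      = contradiction refl (adj-irrefl H adj≡true)
  ... | at-v      | punched y = new-vs-old y adj≡true
  ... | punched x | at-v      = new-vs-old x (trans (Graph.sym H v (punchIn v x)) adj≡true) ∘ sym
  ... | punched x | punched y = λ eq → proper x y (trans (sym (H≅G x y)) adj≡true)
    (trans (sym (insertAt-punchIn col v c₀ x)) (trans eq (insertAt-punchIn col v c₀ y)))

kTree-colouring : ∀ {k} {G : Graph n} → KTree k n G → Σ (Fin n → Fin (suc k)) (IsProperColouring G)
kTree-colouring (base G _) = inject₁ , λ x y adj≡true → adj-irrefl G adj≡true ∘ inject₁-injective
kTree-colouring (step G tree S ∣S∣≡k _ H v H≅G v~S)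
  with col , proper ← kTree-colouring tree
  with c₀ , c₀∉S ← missedColour S (≤-reflexive (cong suc ∣S∣≡k)) col
  = insertAt col v c₀ , insertAt-proper G H v S H≅G v~S proper c₀∉S

subsetOf : ∀ {ℓ} {P : Pred (Fin n) ℓ} → Decidable P → Subset n
subsetOf P? = tabulate (does ∘ P?)

module _ {ℓ} {P : Pred (Fin n) ℓ} (P? : Decidable P) where

  ∈-subsetOf⁺ : ∀ {x} → P x → x ∈ subsetOf P?
  ∈-subsetOf⁺ {x} px = lookup⇒[]= x _ (trans (lookup∘tabulate _ x) (dec-true (P? x) px))

  ∈-subsetOf⁻ : ∀ {x} → x ∈ subsetOf P? → P x
  ∈-subsetOf⁻ {x} x∈ with P? x | trans (sym (lookup∘tabulate _ x)) ([]=⇒lookup x∈)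
  ... | yes px | _ = px
  ... | no  _  | ()

colourClass : (Fin n → Fin c) → Fin c → Subset n
colourClass col c₀ = subsetOf (λ x → col x ≟ c₀)

module _ (col : Fin n → Fin c) (c₀ : Fin c) {x : Fin n} where

  ∈-colourClass⁺ : col x ≡ c₀ → x ∈ colourClass col c₀
  ∈-colourClass⁺ = ∈-subsetOf⁺ (λ y → col y ≟ c₀)

  ∈-colourClass⁻ : x ∈ colourClass col c₀ → col x ≡ c₀
  ∈-colourClass⁻ = ∈-subsetOf⁻ (λ y → col y ≟ c₀)

colourClass-independent : (G : Graph n) {col : Fin n → Fin c} → IsProperColouring G col →
  ∀ c₀ → IsIndependent G (colourClass col c₀)
colourClass-independent G {col} proper c₀ x y x∈ y∈ with adj G x y in adj≡
... | true  = contradiction (trans (∈-colourClass⁻ col c₀ x∈) (sym (∈-colourClass⁻ col c₀ y∈)))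
                            (proper x y adj≡)
... | false = refl

module _ {m} (G : Graph n) (P : List (Subset n)) (cover : IsPerfectCover m G P) where

  private
    member : Fin (length P) → Subset n
    member = L.lookup P

    coverIndex : Fin n → Fin (length P)
    coverIndex x = proj₁ (proj₂ cover x)

    ∈-coverIndex : ∀ x → x ∈ member (coverIndex x)
    ∈-coverIndex x = proj₁ (proj₂ (proj₂ cover x))

    coverIndex-unique : ∀ x i → x ∈ member i → i ≡ coverIndex x
    coverIndex-unique x = proj₂ (proj₂ (proj₂ cover x))

  independent-∣∣≤-cover : ∀ {T} → IsIndependent G T → ∣ T ∣ ≤ length P
  independent-∣∣≤-cover {T} independent =
    ∣S∣≤-injectiveOn T (λ x _ → coverIndex x) sameMember⇒≡
    where
    sameMember⇒≡ : ∀ {x y} → x ∈ T → y ∈ T → coverIndex x ≡ coverIndex y → x ≡ y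
    sameMember⇒≡ {x} {y} x∈T y∈T eq with x ≟ y
    ... | yes x≡y = x≡y
    ... | no  x≢y = contradiction
      (trans (sym (independent x y x∈T y∈T)) (proj₁ (proj₁ cover (coverIndex y)) x y x∈ y∈ x≢y))
      λ ()
      where
      x∈ : x ∈ member (coverIndex y)
      x∈ = subst (λ i → x ∈ member i) eq (∈-coverIndex x)
      y∈ : y ∈ member (coverIndex y)
      y∈ = ∈-coverIndex y

  cover-≤-colourClass : {col : Fin n → Fin m} → IsProperColouring G col →
    ∀ c₀ → length P ≤ ∣ colourClass col c₀ ∣
  cover-≤-colourClass {col} proper c₀ =
    ≤∣S∣-injectiveInto _ (proj₁ ∘ hit) hit-injective (∈-colourClass⁺ col c₀ ∘ proj₂ ∘ proj₂ ∘ hit)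
    where
    hit : ∀ i → Hits (member i) col c₀
    hit i = everyColourHit (member i) col
      (proper⇒injectiveOn-clique G proper (proj₁ (proj₁ cover i)))
      (≤-reflexive (sym (proj₂ (proj₁ cover i)))) c₀
    hit-injective : Injective _≡_ _≡_ (proj₁ ∘ hit)
    hit-injective {i} {j} eq = trans (coverIndex-unique x i (proj₁ (proj₂ (hit i))))
      (sym (coverIndex-unique x j (subst (_∈ member j) (sym eq) (proj₁ (proj₂ (hit j))))))
      where
      x : Fin n
      x = proj₁ (hit i)

colourClass-isAlphaSet : ∀ {m} (G : Graph n) (P : List (Subset n)) → IsPerfectCover m G P →
  {col : Fin n → Fin m} → IsProperColouring G col → ∀ c₀ → IsAlphaSet G (colourClass col c₀)
colourClass-isAlphaSet G P cover proper c₀ =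
  colourClass-independent G proper c₀ ,
  λ T independent → ≤-trans (independent-∣∣≤-cover G P cover independent)
                            (cover-≤-colourClass G P cover proper c₀)

proposition2 : (k : ℕ) → 1 ≤ k → (n : ℕ) (G : Graph n) → KTree k n G →
    HasPerfectCover (suc k) G → AlphaExcellent G
proposition2 k _ n G tree (P , cover) u
  with col , proper ← kTree-colouring tree
  = colourClass col (col u) ,
    colourClass-isAlphaSet G P cover proper (col u) ,
    ∈-colourClass⁺ col (col u) refl
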